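{- Let $A_1,A_2,\dots,A_{2t}\subseteq\Sigma^c$ be sets of keys and $p\subseteq[c]\times\Sigma$ a generalized key. Then the number of $2t$-tuples $(x_1,\dots,x_{2t})\in A_1\times A_2\times\cdots\times A_{2t}$ such that $\Delta_{k\in[2t]}x_k=p$ is at most $((2t-1)!!)^c\prod_{k=1}^{2t}\sqrt{|A_k|}$.
   Context: Each key $x=x_1\cdots x_c\in\Sigma^c$ is identified with its set of position characters $\{(1,x_1),\dots,(c,x_c)\}\subseteq[c]\times\Sigma$. A generalized key is any subset of $[c]\times\Sigma$. $\Delta_k x_k$ denotes the symmetric difference of the sets $x_k$. $(2t-1)!!=(2t-1)(2t-3)\cdots 1$. -}

module Defs where

open import Data.Nat using (ℕ; zero; suc; _+_; _*_)
open import Data.Bool using (Bool; true; false; _xor_)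
open import Data.Fin using (Fin)
open import Data.Fin.Properties using (_≟_)
open import Data.Vec using (Vec; []; _∷_; lookup)
open import Data.List as List using (List; concatMap; map; length; filter)
open import Relation.Nullary.Decidable using (⌊_⌋)
open import Relation.Binary.PropositionalEquality using (_≡_)

Key : ℕ → ℕ → Set
Key c u = Vec (Fin u) c

GenKey : ℕ → ℕ → Set
GenKey c u = Fin c → Fin u → Bool

-- Key viewed as its set of position characters {(i, x_i)}.
posChars : ∀ {c u} → Key c u → GenKey c u
posChars x i a = ⌊ lookup x i ≟ a ⌋

symDiff : ∀ {c u n} → Vec (Key c u) n → GenKey c u
symDiff []       i a = false
symDiff (x ∷ xs) i a = posChars x i a xor symDiff xs i a

tuples : ∀ {X : Set} {n} → Vec (List X) n → List (Vec X n)
tuples []       = List.[ [] ]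
tuples (A ∷ As) = concatMap (λ x → map (x ∷_) (tuples As)) A

-- Double factorial: dfact t = (2t-1)!!
dfact : ℕ → ℕ
dfact zero    = 1
dfact (suc t) = (1 + 2 * t) * dfact t

prodSizes : ∀ {X : Set} {n} → Vec (List X) n → ℕ
prodSizes []       = 1
prodSizes (A ∷ As) = length A * prodSizes As

{-# OPTIONS --safe #-}
-- Split a 2t-tuple into halves x and y of t keys each. Since Δ(x y) = p iff Δx ⊕ p = Δy, the count
-- is a number of equal pairs between the families (Δx ⊕ p)ₓ and (Δy)ᵧ, so by Cauchy–Schwarz its square
-- is at most the product of the two self-pair counts, which count the 2t-tuples with empty symmetric
-- difference from A₁ ⋯ A_t A₁ ⋯ A_t, resp. from the second half taken twice. Such a count is bounded by
-- (2t−1)!!^c √(∏ₖ |Aₖ|) by induction on the number c of characters. For a single character, the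
-- first letter of a tuple in which every letter occurs evenly reappears at one of 2t−1 positions, and
-- removing this pair leaves an even tuple of length 2t−2; Cauchy–Schwarz over the common letter and
-- over the 2t−1 positions yields the factor 2t−1. The induction closes only for weighted sums, so all
-- bounds are stated for weights Y with Y(x)² ≤ R ∏ₖ vₖ(xₖ).
module Submission where

open import Defs
open import Data.Nat using (ℕ; _*_; _^_; _≤_)
open import Data.Vec using (Vec)
open import Data.List using (List; length; filter)
open import Data.List.Relation.Unary.Unique.Propositional using (Unique)
open import Data.Fin.Properties using (all?)
open import Data.Bool.Properties using (_≟_)
open import Data.Vec.Relation.Unary.All as VAll using ()

open import Data.Nat using (zero; suc; _+_; _≤?_; z≤n; s≤s)
open import Data.Nat.Properties hiding (_≟_)
open import Data.Nat.Tactic.RingSolver using (solve-∀)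
open import Algebra.Properties.CommutativeSemigroup +-commutativeSemigroup using () renaming (interchange to +-interchange)
open import Algebra.Properties.CommutativeSemigroup *-commutativeSemigroup using () renaming (interchange to *-interchange; x∙yz≈y∙xz to *-exchange)
open import Data.Bool using (Bool; true; false; _xor_; if_then_else_)
open import Data.Bool.Properties using (xor-assoc; xor-same; not-injective; not-¬; not-distribʳ-xor)
open import Data.Fin using (Fin; zero; suc)
open import Data.Fin.Properties using () renaming (_≟_ to _≟ᶠ_)
open import Data.Vec as Vec using ([]; _∷_; _++_; lookup; replicate; insertAt; removeAt; zipWith; splitAt)
open import Data.Vec.Properties using (removeAt-insertAt; ≡-dec)
open import Data.Vec.Relation.Unary.All.Properties using (++⁺; ++⁻)
open import Data.List using ([]; _∷_; map; concatMap; allFin) renaming (_++_ to _++ˡ_)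
open import Data.List.Properties using (length-filter; filter-reject; length-tabulate)
open import Data.List.Membership.Propositional using (_∈_)
open import Data.List.Membership.Propositional.Properties using (∈-allFin)
open import Data.List.Relation.Unary.Any using (here; there)
open import Data.List.Relation.Unary.All using (All; []; _∷_)
open import Data.List.Relation.Unary.AllPairs using ([]; _∷_)
open import Data.List.Relation.Unary.Unique.Propositional.Properties using (allFin⁺)
open import Data.Product using (∃-syntax; _×_; _,_; proj₁; proj₂)
open import Data.Sum using (inj₁; inj₂)
open import Function using (_⇔_; mk⇔; Equivalence; id; case_of_)
open import Level using (0ℓ)
open import Relation.Binary using (DecSetoid; DecidableEquality)
open import Relation.Binary.PropositionalEquality
open import Relation.Nullary using (Dec; yes; no; _because_; does; ¬_; _×-dec_; ¬?; contradiction)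
open import Relation.Nullary.Decidable using (does-⇔; ⌊_⌋; dec-true; dec-false)

-- Cauchy–Schwarz in ℕ

m*m≤n*n⇒m≤n : ∀ {m n} → m * m ≤ n * n → m ≤ n
m*m≤n*n⇒m≤n {m} {n} m²≤n² with m ≤? n
... | yes m≤n = m≤n
... | no m≰n  = contradiction m²≤n² (<⇒≱ (*-mono-< (≰⇒> m≰n) (≰⇒> m≰n)))

private
  4m[m+d]≤[m+[m+d]]² : ∀ m d → 4 * (m * (m + d)) ≤ (m + (m + d)) * (m + (m + d))
  4m[m+d]≤[m+[m+d]]² m d = subst (4 * (m * (m + d)) ≤_) (expand m d) (m≤m+n _ (d * d))
    where
    expand : ∀ m d → 4 * (m * (m + d)) + d * d ≡ (m + (m + d)) * (m + (m + d))
    expand = solve-∀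

4mn≤[m+n]² : ∀ m n → 4 * (m * n) ≤ (m + n) * (m + n)
4mn≤[m+n]² m n with ≤-total m n
... | inj₁ m≤n with d , refl ← m≤n⇒∃[o]m+o≡n m≤n = 4m[m+d]≤[m+[m+d]]² m d
... | inj₂ n≤m with d , refl ← m≤n⇒∃[o]m+o≡n n≤m =
  subst₂ _≤_ (cong (4 *_) (*-comm n m)) (cong (λ k → k * k) (+-comm n m)) (4m[m+d]≤[m+[m+d]]² n d)

m*m≤n*o⇒2m≤n+o : ∀ {m n o} → m * m ≤ n * o → 2 * m ≤ n + o
m*m≤n*o⇒2m≤n+o {m} {n} {o} m²≤no = m*m≤n*n⇒m≤n (begin
  2 * m * (2 * m)    ≡⟨ square-double m ⟩
  4 * (m * m)        ≤⟨ *-monoʳ-≤ 4 m²≤no ⟩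
  4 * (n * o)        ≤⟨ 4mn≤[m+n]² n o ⟩
  (n + o) * (n + o)  ∎)
  where
  open ≤-Reasoning
  square-double : ∀ m → 2 * m * (2 * m) ≡ 4 * (m * m)
  square-double = solve-∀

cauchy-schwarz₂ : ∀ {x₁ x₂ p₁ p₂ q₁ q₂} → x₁ * x₁ ≤ p₁ * q₁ → x₂ * x₂ ≤ p₂ * q₂ →
                  (x₁ + x₂) * (x₁ + x₂) ≤ (p₁ + p₂) * (q₁ + q₂)
cauchy-schwarz₂ {x₁} {x₂} {p₁} {p₂} {q₁} {q₂} h₁ h₂ = begin
  (x₁ + x₂) * (x₁ + x₂)                    ≡⟨ square-+ x₁ x₂ ⟩
  x₁ * x₁ + x₂ * x₂ + 2 * (x₁ * x₂)        ≤⟨ +-mono-≤ (+-mono-≤ h₁ h₂) cross ⟩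
  p₁ * q₁ + p₂ * q₂ + (p₁ * q₂ + p₂ * q₁)  ≡⟨ expand p₁ p₂ q₁ q₂ ⟩
  (p₁ + p₂) * (q₁ + q₂)                    ∎
  where
  open ≤-Reasoning
  square-+ : ∀ a b → (a + b) * (a + b) ≡ a * a + b * b + 2 * (a * b)
  square-+ = solve-∀
  expand : ∀ a b c d → a * c + b * d + (a * d + b * c) ≡ (a + b) * (c + d)
  expand = solve-∀
  exchange : ∀ a b c d → a * c * (b * d) ≡ a * d * (b * c)
  exchange = solve-∀
  cross : 2 * (x₁ * x₂) ≤ p₁ * q₂ + p₂ * q₁
  cross = m*m≤n*o⇒2m≤n+o {x₁ * x₂} {p₁ * q₂} {p₂ * q₁} (begin
    x₁ * x₂ * (x₁ * x₂)    ≡⟨ *-interchange x₁ x₂ x₁ x₂ ⟩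
    x₁ * x₁ * (x₂ * x₂)    ≤⟨ *-mono-≤ h₁ h₂ ⟩
    p₁ * q₁ * (p₂ * q₂)    ≡⟨ exchange p₁ p₂ q₁ q₂ ⟩
    p₁ * q₂ * (p₂ * q₁)    ∎)

𝟙 : {P : Set} → Dec P → ℕ
𝟙 P? = if does P? then 1 else 0

𝟙-yes : {P : Set} (P? : Dec P) → P → 𝟙 P? ≡ 1
𝟙-yes P? p = cong (if_then 1 else 0) (dec-true P? p)

𝟙-no : {P : Set} (P? : Dec P) → ¬ P → 𝟙 P? ≡ 0
𝟙-no P? ¬p = cong (if_then 1 else 0) (dec-false P? ¬p)

𝟙-*-≤ : ∀ {P : Set} {y z} (P? : Dec P) → (P → y ≤ z) → 𝟙 P? * y ≤ z
𝟙-*-≤ (yes p) y≤z = ≤-trans (≤-reflexive (*-identityˡ _)) (y≤z p)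
𝟙-*-≤ (no _)  y≤z = z≤n

𝟙-⇔ : {P Q : Set} → P ⇔ Q → (P? : Dec P) (Q? : Dec Q) → 𝟙 P? ≡ 𝟙 Q?
𝟙-⇔ P⇔Q P? Q? = cong (if_then 1 else 0) (does-⇔ P⇔Q P? Q?)

𝟙-×-dec : {P Q : Set} (P? : Dec P) (Q? : Dec Q) → 𝟙 (P? ×-dec Q?) ≡ 𝟙 P? * 𝟙 Q?
𝟙-×-dec (true because _)  Q? = sym (+-identityʳ (𝟙 Q?))
𝟙-×-dec (false because _) Q? = refl

∑ : {A : Set} → List A → (A → ℕ) → ℕ
∑ []       f = 0
∑ (x ∷ xs) f = f x + ∑ xs f

infix 5 ∑
syntax ∑ L (λ x → e) = ∑[ x ∈ L ] e

module _ {A : Set} where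

  ∑-cong : ∀ (L : List A) {f g : A → ℕ} → (∀ x → f x ≡ g x) → ∑ L f ≡ ∑ L g
  ∑-cong []       f≗g = refl
  ∑-cong (x ∷ xs) f≗g = cong₂ _+_ (f≗g x) (∑-cong xs f≗g)

  ∑-mono-≤ : ∀ (L : List A) {f g : A → ℕ} → (∀ x → f x ≤ g x) → ∑ L f ≤ ∑ L g
  ∑-mono-≤ []       f≤g = z≤n
  ∑-mono-≤ (x ∷ xs) f≤g = +-mono-≤ (f≤g x) (∑-mono-≤ xs f≤g)

  ∑-zero : ∀ (L : List A) → ∑[ x ∈ L ] 0 ≡ 0
  ∑-zero []       = refl
  ∑-zero (x ∷ xs) = ∑-zero xs

  ∑-distrib-+ : ∀ (L : List A) (f g : A → ℕ) → ∑[ x ∈ L ] (f x + g x) ≡ ∑ L f + ∑ L g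
  ∑-distrib-+ []       f g = refl
  ∑-distrib-+ (x ∷ xs) f g = begin
    f x + g x + (∑[ y ∈ xs ] f y + g y)  ≡⟨ cong (f x + g x +_) (∑-distrib-+ xs f g) ⟩
    f x + g x + (∑ xs f + ∑ xs g)        ≡⟨ +-interchange (f x) (g x) (∑ xs f) (∑ xs g) ⟩
    f x + ∑ xs f + (g x + ∑ xs g)        ∎
    where open ≡-Reasoning

  *-distribˡ-∑ : ∀ k (L : List A) (f : A → ℕ) → k * ∑ L f ≡ ∑[ x ∈ L ] k * f x
  *-distribˡ-∑ k []       f = *-zeroʳ k
  *-distribˡ-∑ k (x ∷ xs) f = trans (*-distribˡ-+ k (f x) (∑ xs f)) (cong (k * f x +_) (*-distribˡ-∑ k xs f))

  *-distribʳ-∑ : ∀ k (L : List A) (f : A → ℕ) → ∑ L f * k ≡ ∑[ x ∈ L ] f x * k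
  *-distribʳ-∑ k L f = trans (*-comm (∑ L f) k) (trans (*-distribˡ-∑ k L f) (∑-cong L (λ x → *-comm k (f x))))

  ∑-const : ∀ (L : List A) k → ∑[ x ∈ L ] k ≡ length L * k
  ∑-const []       k = refl
  ∑-const (x ∷ xs) k = cong (k +_) (∑-const xs k)

  ∑-++ : ∀ (xs ys : List A) (f : A → ℕ) → ∑ (xs ++ˡ ys) f ≡ ∑ xs f + ∑ ys f
  ∑-++ []       ys f = refl
  ∑-++ (x ∷ xs) ys f = trans (cong (f x +_) (∑-++ xs ys f)) (sym (+-assoc (f x) _ _))

  ∈⇒≤∑ : ∀ {L : List A} {x} (f : A → ℕ) → x ∈ L → f x ≤ ∑ L f
  ∈⇒≤∑ {y ∷ ys} f (here refl) = m≤m+n (f y) (∑ ys f)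
  ∈⇒≤∑ {y ∷ ys} f (there x∈) = ≤-trans (∈⇒≤∑ f x∈) (m≤n+m (∑ ys f) (f y))

  ∑-filter : ∀ {P : A → Set} (P? : ∀ x → Dec (P x)) L (f : A → ℕ) → ∑ (filter P? L) f ≡ ∑[ x ∈ L ] 𝟙 (P? x) * f x
  ∑-filter P? []       f = refl
  ∑-filter P? (x ∷ xs) f with does (P? x)
  ... | true  = cong₂ _+_ (sym (+-identityʳ (f x))) (∑-filter P? xs f)
  ... | false = ∑-filter P? xs f

  length-filter≡∑ : ∀ {P : A → Set} (P? : ∀ x → Dec (P x)) L → length (filter P? L) ≡ ∑[ x ∈ L ] 𝟙 (P? x)
  length-filter≡∑ P? []       = refl
  length-filter≡∑ P? (x ∷ xs) with does (P? x)
  ... | true  = cong suc (length-filter≡∑ P? xs)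
  ... | false = length-filter≡∑ P? xs

  ∑-cauchy-schwarz : ∀ (L : List A) {z p q : A → ℕ} → (∀ x → z x * z x ≤ p x * q x) →
                     ∑ L z * ∑ L z ≤ ∑ L p * ∑ L q
  ∑-cauchy-schwarz []       z²≤pq = z≤n
  ∑-cauchy-schwarz (x ∷ xs) {z} {p} {q} z²≤pq =
    cauchy-schwarz₂ {z x} {∑ xs z} {p x} {∑ xs p} {q x} {∑ xs q} (z²≤pq x) (∑-cauchy-schwarz xs z²≤pq)

  ∑-square-≤ : ∀ (L : List A) {w : A → ℕ} B → (∀ x → w x * w x ≤ B) →
               ∑ L w * ∑ L w ≤ length L * length L * B
  ∑-square-≤ L {w} B w²≤B = begin
    ∑ L w * ∑ L w
      ≤⟨ ∑-cauchy-schwarz L {w} {λ _ → 1} {λ _ → B} (λ x → subst (w x * w x ≤_) (sym (*-identityˡ B)) (w²≤B x)) ⟩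
    (∑[ x ∈ L ] 1) * (∑[ x ∈ L ] B)
      ≡⟨ cong₂ _*_ (trans (∑-const L 1) (*-identityʳ (length L))) (∑-const L B) ⟩
    length L * (length L * B)
      ≡⟨ sym (*-assoc (length L) (length L) B) ⟩
    length L * length L * B
      ∎
    where open ≤-Reasoning

module _ {A B : Set} where

  ∑-swap : ∀ (L : List A) (M : List B) (f : A → B → ℕ) →
           ∑[ x ∈ L ] ∑[ y ∈ M ] f x y ≡ ∑[ y ∈ M ] ∑[ x ∈ L ] f x y
  ∑-swap []       M f = sym (∑-zero M)
  ∑-swap (x ∷ xs) M f = trans (cong (∑ M (f x) +_) (∑-swap xs M f)) (sym (∑-distrib-+ M (f x) _))

  ∑-map : ∀ (g : A → B) L (f : B → ℕ) → ∑ (map g L) f ≡ ∑[ x ∈ L ] f (g x)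
  ∑-map g []       f = refl
  ∑-map g (x ∷ xs) f = cong (f (g x) +_) (∑-map g xs f)

  ∑-concatMap : ∀ (g : A → List B) L (f : B → ℕ) → ∑ (concatMap g L) f ≡ ∑[ x ∈ L ] ∑ (g x) f
  ∑-concatMap g []       f = refl
  ∑-concatMap g (x ∷ xs) f = trans (∑-++ (g x) _ f) (cong (∑ (g x) f +_) (∑-concatMap g xs f))

∑-tuples : ∀ {A : Set} {n} (L : List A) (Ls : Vec (List A) n) (F : Vec A (suc n) → ℕ) →
           ∑ (tuples (L ∷ Ls)) F ≡ ∑[ x ∈ L ] ∑[ xs ∈ tuples Ls ] F (x ∷ xs)
∑-tuples L Ls F = trans (∑-concatMap _ L F) (∑-cong L (λ x → ∑-map (x ∷_) (tuples Ls) F))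

∑-tuples-++ : ∀ {A : Set} {m n} (Ls : Vec (List A) m) (Ms : Vec (List A) n) (F : Vec A (m + n) → ℕ) →
              ∑ (tuples (Ls ++ Ms)) F ≡ ∑[ x ∈ tuples Ls ] ∑[ y ∈ tuples Ms ] F (x ++ y)
∑-tuples-++ []       Ms F = sym (+-identityʳ _)
∑-tuples-++ (L ∷ Ls) Ms F = begin
  ∑ (tuples (L ∷ Ls ++ Ms)) F
    ≡⟨ ∑-tuples L (Ls ++ Ms) F ⟩
  ∑[ x ∈ L ] ∑[ xs ∈ tuples (Ls ++ Ms) ] F (x ∷ xs)
    ≡⟨ ∑-cong L (λ x → ∑-tuples-++ Ls Ms (λ xs → F (x ∷ xs))) ⟩
  ∑[ x ∈ L ] ∑[ xs ∈ tuples Ls ] ∑[ y ∈ tuples Ms ] F (x ∷ xs ++ y)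
    ≡⟨ sym (∑-tuples L Ls (λ x → ∑[ y ∈ tuples Ms ] F (x ++ y))) ⟩
  ∑[ x ∈ tuples (L ∷ Ls) ] ∑[ y ∈ tuples Ms ] F (x ++ y)
    ∎
  where open ≡-Reasoning

vectors : ∀ {A : Set} n → List A → List (Vec A n)
vectors n E = tuples (replicate n E)

∑-vectors : ∀ {A : Set} n (E : List A) (F : Vec A (suc n) → ℕ) →
            ∑ (vectors (suc n) E) F ≡ ∑[ a ∈ E ] ∑[ xs ∈ vectors n E ] F (a ∷ xs)
∑-vectors n E = ∑-tuples E (replicate n E)

weight : ∀ {A : Set} {n} → Vec (A → ℕ) n → Vec A n → ℕ
weight []       []       = 1
weight (f ∷ fs) (x ∷ xs) = f x * weight fs xs

total : ∀ {A : Set} {n} → List A → Vec (A → ℕ) n → ℕ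
total E []       = 1
total E (f ∷ fs) = ∑ E f * total E fs

module _ {A : Set} (_≟ᴬ_ : DecidableEquality A) where

  multiplicity : List A → A → ℕ
  multiplicity L b = ∑[ a ∈ L ] 𝟙 (a ≟ᴬ b)

  record Enumerates (E : List A) : Set where
    field multiplicity-one : ∀ b → multiplicity E b ≡ 1
  open Enumerates public

  𝟙-≟-sym : ∀ a b → 𝟙 (a ≟ᴬ b) ≡ 𝟙 (b ≟ᴬ a)
  𝟙-≟-sym a b = 𝟙-⇔ (mk⇔ sym sym) (a ≟ᴬ b) (b ≟ᴬ a)

  ∑-delta : ∀ {E} → Enumerates E → ∀ b (f : A → ℕ) → ∑[ a ∈ E ] 𝟙 (a ≟ᴬ b) * f a ≡ f b
  ∑-delta {E} enum b f = begin
    ∑[ a ∈ E ] 𝟙 (a ≟ᴬ b) * f a  ≡⟨ ∑-cong E 𝟙-subst ⟩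
    ∑[ a ∈ E ] 𝟙 (a ≟ᴬ b) * f b  ≡⟨ sym (*-distribʳ-∑ (f b) E (λ a → 𝟙 (a ≟ᴬ b))) ⟩
    multiplicity E b * f b       ≡⟨ cong (_* f b) (multiplicity-one enum b) ⟩
    1 * f b                      ≡⟨ *-identityˡ (f b) ⟩
    f b                          ∎
    where
    open ≡-Reasoning
    𝟙-subst : ∀ a → 𝟙 (a ≟ᴬ b) * f a ≡ 𝟙 (a ≟ᴬ b) * f b
    𝟙-subst a with a ≟ᴬ b
    ... | yes refl = refl
    ... | no _     = refl

  ∑-multiplicity : ∀ {E} → Enumerates E → ∀ L (f : A → ℕ) → ∑ L f ≡ ∑[ b ∈ E ] multiplicity L b * f b
  ∑-multiplicity {E} enum L f = begin
    ∑[ x ∈ L ] f x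
      ≡⟨ ∑-cong L (λ x → sym (∑-delta enum x f)) ⟩
    ∑[ x ∈ L ] ∑[ b ∈ E ] 𝟙 (b ≟ᴬ x) * f b
      ≡⟨ ∑-swap L E (λ x b → 𝟙 (b ≟ᴬ x) * f b) ⟩
    ∑[ b ∈ E ] ∑[ x ∈ L ] 𝟙 (b ≟ᴬ x) * f b
      ≡⟨ ∑-cong E (λ b → ∑-cong L (λ x → cong (_* f b) (𝟙-≟-sym b x))) ⟩
    ∑[ b ∈ E ] ∑[ x ∈ L ] 𝟙 (x ≟ᴬ b) * f b
      ≡⟨ ∑-cong E (λ b → sym (*-distribʳ-∑ (f b) L (λ x → 𝟙 (x ≟ᴬ b)))) ⟩
    ∑[ b ∈ E ] multiplicity L b * f b
      ∎
    where open ≡-Reasoning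

  ∑-multiplicity-length : ∀ {E} → Enumerates E → ∀ L → ∑ E (multiplicity L) ≡ length L
  ∑-multiplicity-length {E} enum L = begin
    ∑ E (multiplicity L)                ≡⟨ ∑-cong E (λ b → sym (*-identityʳ (multiplicity L b))) ⟩
    ∑[ b ∈ E ] multiplicity L b * 1     ≡⟨ sym (∑-multiplicity enum L (λ _ → 1)) ⟩
    ∑[ x ∈ L ] 1                        ≡⟨ ∑-const L 1 ⟩
    length L * 1                        ≡⟨ *-identityʳ (length L) ⟩
    length L                            ∎
    where open ≡-Reasoning

  multiplicity-∉ : ∀ {b} L → All (b ≢_) L → multiplicity L b ≡ 0
  multiplicity-∉ []       []           = refl
  multiplicity-∉ (x ∷ xs) (b≢x ∷ b∉xs) =
    cong₂ _+_ (𝟙-no (x ≟ᴬ _) (λ x≡b → b≢x (sym x≡b))) (multiplicity-∉ xs b∉xs)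

  multiplicity-unique : ∀ {L} → Unique L → ∀ b → multiplicity L b ≤ 1
  multiplicity-unique {[]}     []           b = z≤n
  multiplicity-unique {x ∷ xs} (x∉xs ∷ uxs) b with x ≟ᴬ b
  ... | yes refl = ≤-reflexive (cong suc (multiplicity-∉ xs x∉xs))
  ... | no _     = multiplicity-unique uxs b

  unique-enumerates : ∀ {E} → Unique E → (∀ b → b ∈ E) → Enumerates E
  unique-enumerates uE complete .multiplicity-one b =
    ≤-antisym (multiplicity-unique uE b)
              (≤-trans (≤-reflexive (sym (𝟙-yes (b ≟ᴬ b) refl))) (∈⇒≤∑ (λ a → 𝟙 (a ≟ᴬ b)) (complete b)))

  ∑-lookup-delta : ∀ {E} → Enumerates E → ∀ {m} (j : Fin (suc m)) b (G : Vec A (suc m) → ℕ) →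
                   ∑[ x ∈ vectors (suc m) E ] 𝟙 (lookup x j ≟ᴬ b) * G x ≡ ∑[ x ∈ vectors m E ] G (insertAt x j b)
  ∑-lookup-delta {E} enum {m} zero b G = begin
    ∑[ x ∈ vectors (suc m) E ] 𝟙 (lookup x zero ≟ᴬ b) * G x
      ≡⟨ ∑-vectors m E _ ⟩
    ∑[ a ∈ E ] ∑[ xs ∈ vectors m E ] 𝟙 (a ≟ᴬ b) * G (a ∷ xs)
      ≡⟨ ∑-cong E (λ a → sym (*-distribˡ-∑ (𝟙 (a ≟ᴬ b)) (vectors m E) (λ xs → G (a ∷ xs)))) ⟩
    ∑[ a ∈ E ] 𝟙 (a ≟ᴬ b) * (∑[ xs ∈ vectors m E ] G (a ∷ xs))
      ≡⟨ ∑-delta enum b (λ a → ∑[ xs ∈ vectors m E ] G (a ∷ xs)) ⟩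
    ∑[ xs ∈ vectors m E ] G (b ∷ xs)
      ∎
    where open ≡-Reasoning
  ∑-lookup-delta {E} enum {suc m} (suc j) b G = begin
    ∑[ x ∈ vectors (2 + m) E ] 𝟙 (lookup x (suc j) ≟ᴬ b) * G x
      ≡⟨ ∑-vectors (suc m) E _ ⟩
    ∑[ a ∈ E ] ∑[ xs ∈ vectors (suc m) E ] 𝟙 (lookup xs j ≟ᴬ b) * G (a ∷ xs)
      ≡⟨ ∑-cong E (λ a → ∑-lookup-delta enum j b (λ xs → G (a ∷ xs))) ⟩
    ∑[ a ∈ E ] ∑[ xs ∈ vectors m E ] G (a ∷ insertAt xs j b)
      ≡⟨ sym (∑-vectors m E _) ⟩
    ∑[ x ∈ vectors (suc m) E ] G (insertAt x (suc j) b)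
      ∎
    where open ≡-Reasoning

  multiplicities : ∀ {n} → Vec (List A) n → Vec (A → ℕ) n
  multiplicities = Vec.map multiplicity

  ∑-tuples-weight : ∀ {E} → Enumerates E → ∀ {n} (Ls : Vec (List A) n) (F : Vec A n → ℕ) →
                    ∑ (tuples Ls) F ≡ ∑[ x ∈ vectors n E ] weight (multiplicities Ls) x * F x
  ∑-tuples-weight enum []       F = cong (_+ 0) (sym (*-identityˡ (F [])))
  ∑-tuples-weight {E} enum {suc n} (L ∷ Ls) F = begin
    ∑ (tuples (L ∷ Ls)) F
      ≡⟨ ∑-tuples L Ls F ⟩
    ∑[ a ∈ L ] ∑[ xs ∈ tuples Ls ] F (a ∷ xs)
      ≡⟨ ∑-cong L (λ a → ∑-tuples-weight enum Ls (λ xs → F (a ∷ xs))) ⟩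
    ∑ L G
      ≡⟨ ∑-multiplicity enum L G ⟩
    ∑[ b ∈ E ] multiplicity L b * G b
      ≡⟨ ∑-cong E (λ b → *-distribˡ-∑ (μ b) (vectors n E) (λ xs → w xs * F (b ∷ xs))) ⟩
    ∑[ b ∈ E ] ∑[ xs ∈ vectors n E ] μ b * (w xs * F (b ∷ xs))
      ≡⟨ ∑-cong E (λ b → ∑-cong (vectors n E) (λ xs → sym (*-assoc (μ b) (w xs) _))) ⟩
    ∑[ b ∈ E ] ∑[ xs ∈ vectors n E ] μ b * w xs * F (b ∷ xs)
      ≡⟨ sym (∑-vectors n E _) ⟩
    ∑[ x ∈ vectors (suc n) E ] weight (multiplicities (L ∷ Ls)) x * F x
      ∎
    where
    open ≡-Reasoning
    μ = multiplicity L
    w = weight (multiplicities Ls)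
    G : A → ℕ
    G a = ∑[ xs ∈ vectors n E ] w xs * F (a ∷ xs)

  weight-multiplicities≤1 : ∀ {n} (Ls : Vec (List A) n) → VAll.All Unique Ls →
                            ∀ x → weight (multiplicities Ls) x ≤ 1
  weight-multiplicities≤1 []       VAll.[]          []       = ≤-refl
  weight-multiplicities≤1 (L ∷ Ls) (uL VAll.∷ uLs) (x ∷ xs) =
    *-mono-≤ (multiplicity-unique uL x) (weight-multiplicities≤1 Ls uLs xs)

  total-multiplicities : ∀ {E} → Enumerates E → ∀ {n} (Ls : Vec (List A) n) →
                         total E (multiplicities Ls) ≡ prodSizes Ls
  total-multiplicities enum []       = refl
  total-multiplicities enum (L ∷ Ls) = cong₂ _*_ (∑-multiplicity-length enum L) (total-multiplicities enum Ls)

enumerates-vectors : ∀ {A : Set} (_≟ᴬ_ : DecidableEquality A) {E} → Enumerates _≟ᴬ_ E →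
                     ∀ n → Enumerates (≡-dec _≟ᴬ_) (vectors n E)
enumerates-vectors _≟ᴬ_ enum zero .multiplicity-one [] = refl
enumerates-vectors _≟ᴬ_ {E} enum (suc n) .multiplicity-one (b ∷ bs) = begin
  multiplicity (≡-dec _≟ᴬ_) (vectors (suc n) E) (b ∷ bs)
    ≡⟨ ∑-vectors n E _ ⟩
  ∑[ a ∈ E ] ∑[ xs ∈ vectors n E ] 𝟙 (≡-dec _≟ᴬ_ (a ∷ xs) (b ∷ bs))
    ≡⟨ ∑-cong E (λ a → ∑-cong (vectors n E) (λ xs → 𝟙-×-dec (a ≟ᴬ b) (≡-dec _≟ᴬ_ xs bs))) ⟩
  ∑[ a ∈ E ] ∑[ xs ∈ vectors n E ] 𝟙 (a ≟ᴬ b) * 𝟙 (≡-dec _≟ᴬ_ xs bs)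
    ≡⟨ ∑-cong E (λ a → sym (*-distribˡ-∑ (𝟙 (a ≟ᴬ b)) (vectors n E) (λ xs → 𝟙 (≡-dec _≟ᴬ_ xs bs)))) ⟩
  ∑[ a ∈ E ] 𝟙 (a ≟ᴬ b) * multiplicity (≡-dec _≟ᴬ_) (vectors n E) bs
    ≡⟨ ∑-delta _≟ᴬ_ enum b (λ _ → multiplicity (≡-dec _≟ᴬ_) (vectors n E) bs) ⟩
  multiplicity (≡-dec _≟ᴬ_) (vectors n E) bs
    ≡⟨ multiplicity-one (enumerates-vectors _≟ᴬ_ enum n) bs ⟩
  1
    ∎
  where open ≡-Reasoning

enumerates-allFin : ∀ u → Enumerates _≟ᶠ_ (allFin u)
enumerates-allFin u = unique-enumerates _≟ᶠ_ (allFin⁺ u) ∈-allFin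

-- Stands for Y(x) ≤ √R ∏ₖ √vₖ(xₖ); squaring keeps everything in ℕ, and fixing some coordinates of x
-- moves their factors into R.
SquareBounded : ∀ {A : Set} {n} → (Vec A n → ℕ) → ℕ → Vec (A → ℕ) n → Set
SquareBounded Y R v = ∀ x → Y x * Y x ≤ R * weight v x

weight-insertAt : ∀ {A : Set} {m} (v : Vec (A → ℕ) (suc m)) x j b →
                  weight v (insertAt x j b) ≡ lookup v j b * weight (removeAt v j) x
weight-insertAt (f ∷ v)         x        zero    b = refl
weight-insertAt (f ∷ v@(_ ∷ _)) (x ∷ xs) (suc j) b = begin
  f x * weight v (insertAt xs j b)                  ≡⟨ cong (f x *_) (weight-insertAt v xs j b) ⟩
  f x * (lookup v j b * weight (removeAt v j) xs)   ≡⟨ *-exchange (f x) (lookup v j b) _ ⟩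
  lookup v j b * (f x * weight (removeAt v j) xs)   ∎
  where open ≡-Reasoning

total-removeAt : ∀ {A : Set} {m} (E : List A) (v : Vec (A → ℕ) (suc m)) j →
                 total E v ≡ ∑ E (lookup v j) * total E (removeAt v j)
total-removeAt E (f ∷ v)         zero    = refl
total-removeAt E (f ∷ v@(_ ∷ _)) (suc j) = begin
  ∑ E f * total E v                                       ≡⟨ cong (∑ E f *_) (total-removeAt E v j) ⟩
  ∑ E f * (∑ E (lookup v j) * total E (removeAt v j))     ≡⟨ *-exchange (∑ E f) (∑ E (lookup v j)) _ ⟩
  ∑ E (lookup v j) * (∑ E f * total E (removeAt v j))     ∎
  where open ≡-Reasoning

-- For even n this is (n-1)!!, the number of perfect matchings of n points; there are none for odd n.
matchings : ℕ → ℕ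
matchings 0             = 1
matchings 1             = 0
matchings (suc (suc n)) = suc n * matchings n

matchings-double : ∀ t → matchings (t + t) ≡ dfact t
matchings-double zero    = refl
matchings-double (suc t) rewrite +-suc t t =
  cong₂ _*_ (cong (λ k → suc (t + k)) (sym (+-identityʳ t))) (matchings-double t)

-- Tuples of letters in which every letter occurs evenly

xor-cancelˡ : ∀ x y → x xor (x xor y) ≡ y
xor-cancelˡ x y = trans (sym (xor-assoc x x y)) (cong (_xor y) (xor-same x))

xor-exchange : ∀ x y z → x xor (y xor z) ≡ y xor (x xor z)
xor-exchange true  y z = not-distribʳ-xor y z
xor-exchange false y z = refl

xor-≡-⇔ : ∀ x y z → (x xor y ≡ z) ⇔ (x xor z ≡ y xor false)
xor-≡-⇔ false false z = mk⇔ sym sym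
xor-≡-⇔ false true  z = mk⇔ sym sym
xor-≡-⇔ true  false z = mk⇔ (λ { refl → refl }) (λ e → sym (not-injective e))
xor-≡-⇔ true  true  z = mk⇔ (λ { refl → refl }) (λ e → sym (not-injective e))

xor-cancelʳ-⇔ : ∀ x y z → (x xor z ≡ y xor z) ⇔ (x xor y ≡ false)
xor-cancelʳ-⇔ false false z = mk⇔ (λ _ → refl) (λ _ → refl)
xor-cancelʳ-⇔ true  true  z = mk⇔ (λ _ → refl) (λ _ → refl)
xor-cancelʳ-⇔ false true  z = mk⇔ (λ e → contradiction e (not-¬ refl)) (λ ())
xor-cancelʳ-⇔ true  false z = mk⇔ (λ e → contradiction (sym e) (not-¬ refl)) (λ ())

parity : ∀ {u n} → Vec (Fin u) n → Fin u → Bool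
parity []       a = false
parity (x ∷ xs) a = ⌊ x ≟ᶠ a ⌋ xor parity xs a

Even : ∀ {u n} → Vec (Fin u) n → Set
Even xs = ∀ a → parity xs a ≡ false

even? : ∀ {u n} (xs : Vec (Fin u) n) → Dec (Even xs)
even? xs = all? (λ a → parity xs a ≟ false)

parity-removeAt : ∀ {u m} (xs : Vec (Fin u) (suc m)) j a →
                  parity xs a ≡ ⌊ lookup xs j ≟ᶠ a ⌋ xor parity (removeAt xs j) a
parity-removeAt (x ∷ xs)         zero    a = refl
parity-removeAt (x ∷ xs@(_ ∷ _)) (suc j) a =
  trans (cong (⌊ x ≟ᶠ a ⌋ xor_) (parity-removeAt xs j a))
        (xor-exchange ⌊ x ≟ᶠ a ⌋ ⌊ lookup xs j ≟ᶠ a ⌋ (parity (removeAt xs j) a))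

parity-true⇒lookup : ∀ {u n} (xs : Vec (Fin u) n) a → parity xs a ≡ true → ∃[ j ] lookup xs j ≡ a
parity-true⇒lookup (x ∷ xs) a odd with x ≟ᶠ a
... | yes x≡a = zero , x≡a
... | no _    = let j , xs[j]≡a = parity-true⇒lookup xs a odd in suc j , xs[j]≡a

even-∷⇒odd : ∀ {u n} {b} (xs : Vec (Fin u) n) → Even (b ∷ xs) → parity xs b ≡ true
even-∷⇒odd {b = b} xs even = not-injective (trans (cong (_xor parity xs b) (sym ⌊b≟b⌋)) (even b))
  where
  ⌊b≟b⌋ : ⌊ b ≟ᶠ b ⌋ ≡ true
  ⌊b≟b⌋ = cong ⌊_⌋ (≡-≟-identity _≟ᶠ_ refl)

even-∷⇒partner : ∀ {u m} {b} (xs : Vec (Fin u) (suc m)) → Even (b ∷ xs) →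
                 ∃[ j ] lookup xs j ≡ b × Even (removeAt xs j)
even-∷⇒partner {b = b} xs even = j , xs[j]≡b , even-rest
  where
  j = proj₁ (parity-true⇒lookup xs b (even-∷⇒odd xs even))
  xs[j]≡b = proj₂ (parity-true⇒lookup xs b (even-∷⇒odd xs even))
  even-rest : Even (removeAt xs j)
  even-rest a = begin
    parity (removeAt xs j) a
      ≡⟨ sym (xor-cancelˡ ⌊ b ≟ᶠ a ⌋ _) ⟩
    ⌊ b ≟ᶠ a ⌋ xor (⌊ b ≟ᶠ a ⌋ xor parity (removeAt xs j) a)
      ≡⟨ cong (λ c → ⌊ b ≟ᶠ a ⌋ xor (⌊ c ≟ᶠ a ⌋ xor parity (removeAt xs j) a)) (sym xs[j]≡b) ⟩
    ⌊ b ≟ᶠ a ⌋ xor (⌊ lookup xs j ≟ᶠ a ⌋ xor parity (removeAt xs j) a)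
      ≡⟨ cong (⌊ b ≟ᶠ a ⌋ xor_) (sym (parity-removeAt xs j a)) ⟩
    parity (b ∷ xs) a
      ≡⟨ even a ⟩
    false
      ∎
    where open ≡-Reasoning

evenSum : ∀ {u} n → (Vec (Fin u) n → ℕ) → ℕ
evenSum {u} n Y = ∑[ x ∈ vectors n (allFin u) ] 𝟙 (even? x) * Y x

pairedSum : ∀ {u m} → (Vec (Fin u) (2 + m) → ℕ) → Fin (suc m) → ℕ
pairedSum {u} {m} Y j = ∑[ b ∈ allFin u ] evenSum m (λ x → Y (b ∷ insertAt x j b))

-- The first letter b of an even tuple occurs again at some position j, and removing both occurrences
-- leaves an even tuple.
evenSum-≤-∑-pairedSum : ∀ {u} m (Y : Vec (Fin u) (2 + m) → ℕ) →
                        evenSum (2 + m) Y ≤ ∑ (allFin (suc m)) (pairedSum Y)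
evenSum-≤-∑-pairedSum {u} m Y = begin
  evenSum (2 + m) Y
    ≡⟨ ∑-vectors (suc m) Σ _ ⟩
  ∑[ b ∈ Σ ] ∑[ x ∈ vectors (suc m) Σ ] 𝟙 (even? (b ∷ x)) * Y (b ∷ x)
    ≤⟨ ∑-mono-≤ Σ (λ b → ∑-mono-≤ (vectors (suc m) Σ) (even-term-≤ b)) ⟩
  ∑[ b ∈ Σ ] ∑[ x ∈ vectors (suc m) Σ ] ∑[ j ∈ positions ] T b x j
    ≡⟨ ∑-cong Σ (λ b → ∑-swap (vectors (suc m) Σ) positions (T b)) ⟩
  ∑[ b ∈ Σ ] ∑[ j ∈ positions ] ∑[ x ∈ vectors (suc m) Σ ] T b x j
    ≡⟨ ∑-swap Σ positions (λ b j → ∑[ x ∈ vectors (suc m) Σ ] T b x j) ⟩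
  ∑[ j ∈ positions ] ∑[ b ∈ Σ ] ∑[ x ∈ vectors (suc m) Σ ] T b x j
    ≡⟨ ∑-cong positions (λ j → ∑-cong Σ (remove-partner j)) ⟩
  ∑ positions (pairedSum Y)
    ∎
  where
  open ≤-Reasoning
  Σ = allFin u
  positions = allFin (suc m)
  T : Fin u → Vec (Fin u) (suc m) → Fin (suc m) → ℕ
  T b x j = 𝟙 (lookup x j ≟ᶠ b) * (𝟙 (even? (removeAt x j)) * Y (b ∷ x))

  even-term-≤ : ∀ b x → 𝟙 (even? (b ∷ x)) * Y (b ∷ x) ≤ ∑ positions (T b x)
  even-term-≤ b x = 𝟙-*-≤ (even? (b ∷ x)) λ even →
    let j , x[j]≡b , even-rest = even-∷⇒partner x even
        T≡Y = trans (cong₂ (λ p q → p * (q * Y (b ∷ x))) (𝟙-yes (lookup x j ≟ᶠ b) x[j]≡b)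
                                                         (𝟙-yes (even? (removeAt x j)) even-rest))
                    (trans (*-identityˡ _) (*-identityˡ _))
    in ≤-trans (≤-reflexive (sym T≡Y)) (∈⇒≤∑ (T b x) (∈-allFin j))

  remove-partner : ∀ j b → ∑[ x ∈ vectors (suc m) Σ ] T b x j ≡ evenSum m (λ x → Y (b ∷ insertAt x j b))
  remove-partner j b =
    trans (∑-lookup-delta _≟ᶠ_ (enumerates-allFin u) j b (λ x → 𝟙 (even? (removeAt x j)) * Y (b ∷ x)))
          (∑-cong (vectors m Σ) (λ x → cong (λ z → 𝟙 (even? z) * Y (b ∷ insertAt x j b)) (removeAt-insertAt x j b)))

EvenSumBound : ℕ → ℕ → Set
EvenSumBound u n = ∀ (Y : Vec (Fin u) n → ℕ) v R → SquareBounded Y R v →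
                   evenSum n Y * evenSum n Y ≤ matchings n * matchings n * R * total (allFin u) v

pairedSum-bound : ∀ {u m} → EvenSumBound u m →
                  ∀ (Y : Vec (Fin u) (2 + m) → ℕ) v₀ vs R → SquareBounded Y R (v₀ ∷ vs) → ∀ j →
                  pairedSum Y j * pairedSum Y j ≤ matchings m * matchings m * R * total (allFin u) (v₀ ∷ vs)
pairedSum-bound {u} {m} bound Y v₀ vs R Y²≤ j = begin
  pairedSum Y j * pairedSum Y j
    ≤⟨ ∑-cauchy-schwarz Σ {Z} {v₀} {λ b → vⱼ b * K} Z²≤ ⟩
  ∑ Σ v₀ * (∑[ b ∈ Σ ] vⱼ b * K)
    ≡⟨ cong (∑ Σ v₀ *_) (sym (*-distribʳ-∑ K Σ vⱼ)) ⟩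
  ∑ Σ v₀ * (∑ Σ vⱼ * K)
    ≡⟨ regroup-total (∑ Σ v₀) (∑ Σ vⱼ) M R T ⟩
  M * M * R * (∑ Σ v₀ * (∑ Σ vⱼ * T))
    ≡⟨ cong (λ t → M * M * R * (∑ Σ v₀ * t)) (sym (total-removeAt Σ vs j)) ⟩
  M * M * R * total Σ (v₀ ∷ vs)
    ∎
  where
  open ≤-Reasoning
  Σ = allFin u
  M = matchings m
  vⱼ = lookup vs j
  T = total Σ (removeAt vs j)
  K = M * M * R * T
  Z : Fin u → ℕ
  Z b = evenSum m (λ x → Y (b ∷ insertAt x j b))
  regroup-total : ∀ a c M R T → a * (c * (M * M * R * T)) ≡ M * M * R * (a * (c * T))
  regroup-total = solve-∀
  regroup-weight : ∀ R a c w → R * (a * (c * w)) ≡ R * (a * c) * w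
  regroup-weight = solve-∀
  regroup-bound : ∀ M R a c T → M * M * (R * (a * c)) * T ≡ a * (c * (M * M * R * T))
  regroup-bound = solve-∀
  Z²≤ : ∀ b → Z b * Z b ≤ v₀ b * (vⱼ b * K)
  Z²≤ b = ≤-trans (bound _ (removeAt vs j) (R * (v₀ b * vⱼ b)) hyp)
                  (≤-reflexive (regroup-bound M R (v₀ b) (vⱼ b) T))
    where
    hyp : SquareBounded (λ x → Y (b ∷ insertAt x j b)) (R * (v₀ b * vⱼ b)) (removeAt vs j)
    hyp x = ≤-trans (Y²≤ (b ∷ insertAt x j b))
      (≤-reflexive (trans (cong (λ w → R * (v₀ b * w)) (weight-insertAt vs x j b))
                          (regroup-weight R (v₀ b) (vⱼ b) (weight (removeAt vs j) x))))

evenSum-bound : ∀ {u} n → EvenSumBound u n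
evenSum-bound {u} 0 Y [] R Y²≤ = begin
  evenSum 0 Y * evenSum 0 Y  ≡⟨ cong (λ s → s * s) evenSum≡Y ⟩
  Y [] * Y []                ≤⟨ Y²≤ [] ⟩
  R * 1                      ≡⟨ cong (_* 1) (sym (*-identityˡ R)) ⟩
  1 * 1 * R * 1              ∎
  where
  open ≤-Reasoning
  evenSum≡Y : evenSum 0 Y ≡ Y []
  evenSum≡Y = trans (+-identityʳ _)
                    (trans (cong (_* Y []) (𝟙-yes (even? {u} []) (λ _ → refl))) (*-identityˡ (Y [])))
evenSum-bound {u} 1 Y (_ ∷ []) R _ = ≤-reflexive (cong (λ s → s * s) evenSum≡0)
  where
  odd : ∀ b → ¬ Even (b ∷ [])
  odd b even = case even-∷⇒odd {b = b} [] even of λ ()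
  evenSum≡0 : evenSum 1 Y ≡ 0
  evenSum≡0 = trans (∑-cong (vectors 1 (allFin u))
                             λ { (b ∷ []) → cong (_* Y (b ∷ [])) (𝟙-no (even? (b ∷ [])) (odd b)) })
                    (∑-zero (vectors 1 (allFin u)))
evenSum-bound {u} (suc (suc m)) Y (v₀ ∷ vs) R Y²≤ = begin
  evenSum (2 + m) Y * evenSum (2 + m) Y
    ≤⟨ *-mono-≤ S≤ S≤ ⟩
  ∑ positions W * ∑ positions W
    ≤⟨ ∑-square-≤ positions {W} B (pairedSum-bound (evenSum-bound m) Y v₀ vs R Y²≤) ⟩
  length positions * length positions * B
    ≡⟨ cong (λ k → k * k * B) (length-tabulate {n = suc m} id) ⟩
  suc m * suc m * B
    ≡⟨ regroup (suc m) (matchings m) R (total (allFin u) (v₀ ∷ vs)) ⟩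
  matchings (2 + m) * matchings (2 + m) * R * total (allFin u) (v₀ ∷ vs)
    ∎
  where
  open ≤-Reasoning
  positions = allFin (suc m)
  W = pairedSum Y
  B = matchings m * matchings m * R * total (allFin u) (v₀ ∷ vs)
  S≤ : evenSum (2 + m) Y ≤ ∑ positions W
  S≤ = evenSum-≤-∑-pairedSum m Y
  regroup : ∀ k M R T → k * k * (M * M * R * T) ≡ k * M * (k * M) * R * T
  regroup = solve-∀

-- Tuples of keys with empty symmetric difference

∑-vectors-singleton : ∀ {A : Set} n (e : A) (F : Vec A n → ℕ) →
                      ∑ (vectors n (e ∷ [])) F ≡ F (replicate n e)
∑-vectors-singleton zero    e F = +-identityʳ (F [])
∑-vectors-singleton (suc n) e F = begin
  ∑ (vectors (suc n) (e ∷ [])) F                       ≡⟨ ∑-vectors n (e ∷ []) F ⟩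
  (∑[ xs ∈ vectors n (e ∷ []) ] F (e ∷ xs)) + 0        ≡⟨ +-identityʳ _ ⟩
  ∑[ xs ∈ vectors n (e ∷ []) ] F (e ∷ xs)              ≡⟨ ∑-vectors-singleton n e (λ xs → F (e ∷ xs)) ⟩
  F (replicate (suc n) e)                              ∎
  where open ≡-Reasoning

total-singleton : ∀ {A : Set} {n} (e : A) (v : Vec (A → ℕ) n) →
                  total (e ∷ []) v ≡ weight v (replicate n e)
total-singleton e []      = refl
total-singleton e (f ∷ v) = cong₂ _*_ (+-identityʳ (f e)) (total-singleton e v)

∑-vectors-zip : ∀ {A : Set} {c} n (E : List A) (F : Vec (Vec A (suc c)) n → ℕ) →
                ∑ (vectors n (vectors (suc c) E)) F
                  ≡ ∑[ b ∈ vectors n E ] ∑[ r ∈ vectors n (vectors c E) ] F (zipWith _∷_ b r)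
∑-vectors-zip zero E F = sym (+-identityʳ _)
∑-vectors-zip {c = c} (suc n) E F = begin
  ∑ (vectors (suc n) (vectors (suc c) E)) F
    ≡⟨ ∑-vectors n (vectors (suc c) E) F ⟩
  ∑[ k ∈ vectors (suc c) E ] ∑[ ks ∈ vectors n (vectors (suc c) E) ] F (k ∷ ks)
    ≡⟨ ∑-vectors c E _ ⟩
  ∑[ a ∈ E ] ∑[ r₀ ∈ vectors c E ] ∑[ ks ∈ vectors n (vectors (suc c) E) ] F ((a ∷ r₀) ∷ ks)
    ≡⟨ ∑-cong E (λ a → ∑-cong (vectors c E) (λ r₀ → ∑-vectors-zip n E (λ ks → F ((a ∷ r₀) ∷ ks)))) ⟩
  ∑[ a ∈ E ] ∑[ r₀ ∈ vectors c E ] ∑[ b ∈ vectors n E ] ∑[ r ∈ vectors n (vectors c E) ] F ((a ∷ r₀) ∷ zipWith _∷_ b r)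
    ≡⟨ ∑-cong E (λ a → ∑-swap (vectors c E) (vectors n E) _) ⟩
  ∑[ a ∈ E ] ∑[ b ∈ vectors n E ] ∑[ r₀ ∈ vectors c E ] ∑[ r ∈ vectors n (vectors c E) ] F ((a ∷ r₀) ∷ zipWith _∷_ b r)
    ≡⟨ ∑-cong E (λ a → ∑-cong (vectors n E) (λ b → sym (∑-vectors n (vectors c E) (λ r → F (zipWith _∷_ (a ∷ b) r))))) ⟩
  ∑[ a ∈ E ] ∑[ b ∈ vectors n E ] ∑[ r ∈ vectors (suc n) (vectors c E) ] F (zipWith _∷_ (a ∷ b) r)
    ≡⟨ sym (∑-vectors n E _) ⟩
  ∑[ b ∈ vectors (suc n) E ] ∑[ r ∈ vectors (suc n) (vectors c E) ] F (zipWith _∷_ b r)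
    ∎
  where open ≡-Reasoning

sections : ∀ {A : Set} {c n} → Vec (Vec A (suc c) → ℕ) n → Vec A n → Vec (Vec A c → ℕ) n
sections = zipWith (λ f a r → f (a ∷ r))

marginals : ∀ {A : Set} {c n} → List (Vec A c) → Vec (Vec A (suc c) → ℕ) n → Vec (A → ℕ) n
marginals Es = Vec.map (λ f a → ∑[ r ∈ Es ] f (a ∷ r))

weight-zip : ∀ {A : Set} {c n} (v : Vec (Vec A (suc c) → ℕ) n) b r →
             weight v (zipWith _∷_ b r) ≡ weight (sections v b) r
weight-zip []      []      []       = refl
weight-zip (f ∷ v) (a ∷ b) (r₀ ∷ r) = cong (f (a ∷ r₀) *_) (weight-zip v b r)

total-sections : ∀ {A : Set} {c n} (Es : List (Vec A c)) (v : Vec (Vec A (suc c) → ℕ) n) b →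
                 total Es (sections v b) ≡ weight (marginals Es v) b
total-sections Es []      []      = refl
total-sections Es (f ∷ v) (a ∷ b) = cong (∑ Es (λ r → f (a ∷ r)) *_) (total-sections Es v b)

total-marginals : ∀ {A : Set} {c n} (E : List A) (v : Vec (Vec A (suc c) → ℕ) n) →
                  total E (marginals (vectors c E) v) ≡ total (vectors (suc c) E) v
total-marginals E []      = refl
total-marginals {c = c} E (f ∷ v) = cong₂ _*_ (sym (∑-vectors c E f)) (total-marginals E v)

keys : ∀ c u → List (Key c u)
keys c u = vectors c (allFin u)

enumerates-keys : ∀ c u → Enumerates (≡-dec _≟ᶠ_) (keys c u)
enumerates-keys c u = enumerates-vectors _≟ᶠ_ (enumerates-allFin u) c

∅ : ∀ {c u} → GenKey c u
∅ _ _ = false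

infix 4 _≐_ _≐?_

_≐_ : ∀ {c u} → GenKey c u → GenKey c u → Set
g ≐ h = ∀ i a → g i a ≡ h i a

_≐?_ : ∀ {c u} (g h : GenKey c u) → Dec (g ≐ h)
g ≐? h = all? (λ i → all? (λ a → g i a ≟ h i a))

symDiff-zip-zero : ∀ {c u n} (b : Vec (Fin u) n) (r : Vec (Key c u) n) a →
                   symDiff (zipWith _∷_ b r) zero a ≡ parity b a
symDiff-zip-zero []      []       a = refl
symDiff-zip-zero (x ∷ b) (r₀ ∷ r) a = cong (⌊ x ≟ᶠ a ⌋ xor_) (symDiff-zip-zero b r a)

symDiff-zip-suc : ∀ {c u n} (b : Vec (Fin u) n) (r : Vec (Key c u) n) i a →
                  symDiff (zipWith _∷_ b r) (suc i) a ≡ symDiff r i a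
symDiff-zip-suc []      []       i a = refl
symDiff-zip-suc (x ∷ b) (r₀ ∷ r) i a = cong (posChars r₀ i a xor_) (symDiff-zip-suc b r i a)

symDiff-zip-≐∅ : ∀ {c u n} (b : Vec (Fin u) n) (r : Vec (Key c u) n) →
                 (symDiff (zipWith _∷_ b r) ≐ ∅) ⇔ (Even b × symDiff r ≐ ∅)
symDiff-zip-≐∅ b r = mk⇔
  (λ empty → (λ a → trans (sym (symDiff-zip-zero b r a)) (empty zero a))
           , (λ i a → trans (sym (symDiff-zip-suc b r i a)) (empty (suc i) a)))
  (λ (even , empty) → λ { zero a → trans (symDiff-zip-zero b r a) (even a)
                        ; (suc i) a → trans (symDiff-zip-suc b r i a) (empty i a) })

emptySum : ∀ {c u} n → (Vec (Key c u) n → ℕ) → ℕ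
emptySum {c} {u} n Y = ∑[ x ∈ vectors n (keys c u) ] 𝟙 (symDiff x ≐? ∅) * Y x

emptySum-heads : ∀ {c u} n (Y : Vec (Key (suc c) u) n → ℕ) →
                 emptySum n Y ≡ evenSum n (λ b → emptySum n (λ r → Y (zipWith _∷_ b r)))
emptySum-heads {c} {u} n Y = begin
  emptySum n Y
    ≡⟨ ∑-vectors-zip n (allFin u) _ ⟩
  ∑[ b ∈ vectors n (allFin u) ] ∑[ r ∈ vectors n (keys c u) ] 𝟙 (symDiff (zipWith _∷_ b r) ≐? ∅) * Y (zipWith _∷_ b r)
    ≡⟨ ∑-cong (vectors n (allFin u)) (λ b → ∑-cong (vectors n (keys c u)) (indicator-split b)) ⟩
  ∑[ b ∈ vectors n (allFin u) ] ∑[ r ∈ vectors n (keys c u) ] 𝟙 (even? b) * (𝟙 (symDiff r ≐? ∅) * Y (zipWith _∷_ b r))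
    ≡⟨ ∑-cong (vectors n (allFin u)) (λ b → sym (*-distribˡ-∑ (𝟙 (even? b)) (vectors n (keys c u)) _)) ⟩
  evenSum n (λ b → emptySum n (λ r → Y (zipWith _∷_ b r)))
    ∎
  where
  open ≡-Reasoning
  indicator-split : ∀ b r → 𝟙 (symDiff (zipWith _∷_ b r) ≐? ∅) * Y (zipWith _∷_ b r)
                          ≡ 𝟙 (even? b) * (𝟙 (symDiff r ≐? ∅) * Y (zipWith _∷_ b r))
  indicator-split b r = trans
    (cong (_* Y (zipWith _∷_ b r))
          (trans (𝟙-⇔ (symDiff-zip-≐∅ b r) (symDiff (zipWith _∷_ b r) ≐? ∅) (even? b ×-dec (symDiff r ≐? ∅)))
                 (𝟙-×-dec (even? b) (symDiff r ≐? ∅))))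
    (*-assoc (𝟙 (even? b)) _ _)

emptySum-bound : ∀ c {u} n (Y : Vec (Key c u) n → ℕ) (v : Vec (Key c u → ℕ) n) R → SquareBounded Y R v →
                 emptySum n Y * emptySum n Y ≤ matchings n ^ c * matchings n ^ c * R * total (keys c u) v
emptySum-bound zero {u} n Y v R Y²≤ = begin
  emptySum n Y * emptySum n Y           ≤⟨ *-mono-≤ S≤Y S≤Y ⟩
  Y ε * Y ε                             ≤⟨ Y²≤ ε ⟩
  R * weight v ε                        ≡⟨ cong (R *_) (sym (total-singleton [] v)) ⟩
  R * total (keys 0 u) v                ≡⟨ cong (_* total (keys 0 u) v) (sym (*-identityˡ R)) ⟩
  1 * 1 * R * total (keys 0 u) v        ∎
  where
  open ≤-Reasoning
  ε = replicate n []
  S≤Y : emptySum n Y ≤ Y ε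
  S≤Y = ≤-trans (≤-reflexive (∑-vectors-singleton n [] _)) (𝟙-*-≤ (symDiff ε ≐? ∅) (λ _ → ≤-refl))
emptySum-bound (suc c) {u} n Y v R Y²≤ = begin
  emptySum n Y * emptySum n Y
    ≡⟨ cong (λ s → s * s) (emptySum-heads n Y) ⟩
  evenSum n W * evenSum n W
    ≤⟨ evenSum-bound n W (marginals (keys c u) v) (D * D * R) W-bound ⟩
  M * M * (D * D * R) * total (allFin u) (marginals (keys c u) v)
    ≡⟨ cong (M * M * (D * D * R) *_) (total-marginals (allFin u) v) ⟩
  M * M * (D * D * R) * total (keys (suc c) u) v
    ≡⟨ regroup M D R _ ⟩
  M * D * (M * D) * R * total (keys (suc c) u) v
    ∎
  where
  open ≤-Reasoning
  M = matchings n
  D = M ^ c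
  W : Vec (Fin u) n → ℕ
  W b = emptySum n (λ r → Y (zipWith _∷_ b r))
  W-bound : SquareBounded W (D * D * R) (marginals (keys c u) v)
  W-bound b = subst (W b * W b ≤_) (cong (D * D * R *_) (total-sections (keys c u) v b))
    (emptySum-bound c n (λ r → Y (zipWith _∷_ b r)) (sections v b) R
      (λ r → subst (λ w → _ ≤ R * w) (weight-zip v b r) (Y²≤ (zipWith _∷_ b r))))
  regroup : ∀ M D R T → M * M * (D * D * R) * T ≡ M * D * (M * D) * R * T
  regroup = solve-∀

emptyCount : ∀ {c u n} → Vec (List (Key c u)) n → ℕ
emptyCount A = ∑[ x ∈ tuples A ] 𝟙 (symDiff x ≐? ∅)

emptyCount-bound : ∀ {c u n} (A : Vec (List (Key c u)) n) → VAll.All Unique A →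
                   emptyCount A * emptyCount A ≤ matchings n ^ c * matchings n ^ c * prodSizes A
emptyCount-bound {c} {u} {n} A uA = begin
  emptyCount A * emptyCount A
    ≡⟨ cong (λ s → s * s) emptyCount≡emptySum ⟩
  emptySum n Y * emptySum n Y
    ≤⟨ emptySum-bound c n Y mults 1 Y²≤ ⟩
  D * D * 1 * total (keys c u) mults
    ≡⟨ cong₂ _*_ (*-identityʳ (D * D)) (total-multiplicities _≟ᵏ_ (enumerates-keys c u) A) ⟩
  D * D * prodSizes A
    ∎
  where
  open ≤-Reasoning
  _≟ᵏ_ = ≡-dec _≟ᶠ_
  D = matchings n ^ c
  mults = multiplicities _≟ᵏ_ A
  Y = weight mults
  emptyCount≡emptySum : emptyCount A ≡ emptySum n Y
  emptyCount≡emptySum = trans (∑-tuples-weight _≟ᵏ_ (enumerates-keys c u) A _)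
                              (∑-cong (vectors n (keys c u)) (λ x → *-comm (Y x) _))
  Y²≤ : SquareBounded Y 1 mults
  Y²≤ x = *-monoˡ-≤ (Y x) (weight-multiplicities≤1 _≟ᵏ_ A uA x)

prodSizes-++ : ∀ {X : Set} {m n} (A : Vec (List X) m) (B : Vec (List X) n) →
               prodSizes (A ++ B) ≡ prodSizes A * prodSizes B
prodSizes-++ []      B = sym (+-identityʳ (prodSizes B))
prodSizes-++ (L ∷ A) B = trans (cong (length L *_) (prodSizes-++ A B)) (sym (*-assoc (length L) _ _))

emptyCount-++-self : ∀ {c u} t (A : Vec (List (Key c u)) t) → VAll.All Unique A →
                     emptyCount (A ++ A) ≤ dfact t ^ c * prodSizes A
emptyCount-++-self {c} t A uA = m*m≤n*n⇒m≤n (begin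
  emptyCount (A ++ A) * emptyCount (A ++ A)                 ≤⟨ emptyCount-bound (A ++ A) (++⁺ uA uA) ⟩
  matchings (t + t) ^ c * matchings (t + t) ^ c * prodSizes (A ++ A)
    ≡⟨ cong₂ (λ m p → m ^ c * m ^ c * p) (matchings-double t) (prodSizes-++ A A) ⟩
  dfact t ^ c * dfact t ^ c * (prodSizes A * prodSizes A)   ≡⟨ regroup (dfact t ^ c) (prodSizes A) ⟩
  dfact t ^ c * prodSizes A * (dfact t ^ c * prodSizes A)   ∎)
  where
  open ≤-Reasoning
  regroup : ∀ d p → d * d * (p * p) ≡ d * p * (d * p)
  regroup = solve-∀

-- Counting equal pairs

module EqualPairs (S : DecSetoid 0ℓ 0ℓ) where

  open DecSetoid S using () renaming (Carrier to G; _≟_ to _≈?_; refl to ≈-refl; sym to ≈-sym; trans to ≈-trans)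

  pairs : List G → List G → ℕ
  pairs L M = ∑[ a ∈ L ] ∑[ b ∈ M ] 𝟙 (a ≈? b)

  class-size : G → List G → ℕ
  class-size a₀ L = ∑[ a ∈ L ] 𝟙 (a₀ ≈? a)

  outside : G → List G → List G
  outside a₀ = filter (λ a → ¬? (a₀ ≈? a))

  𝟙-≈-split : ∀ a₀ a b → 𝟙 (a ≈? b) ≡ 𝟙 (a₀ ≈? a) * 𝟙 (a₀ ≈? b)
                                     + 𝟙 (¬? (a₀ ≈? a)) * (𝟙 (¬? (a₀ ≈? b)) * 𝟙 (a ≈? b))
  𝟙-≈-split a₀ a b with a₀ ≈? a | a₀ ≈? b | a ≈? b
  ... | yes _   | yes _   | yes _   = refl
  ... | yes a₀a | yes a₀b | no ¬ab  = contradiction (≈-trans (≈-sym a₀a) a₀b) ¬ab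
  ... | yes a₀a | no ¬a₀b | yes ab  = contradiction (≈-trans a₀a ab) ¬a₀b
  ... | yes _   | no _    | no _    = refl
  ... | no ¬a₀a | yes a₀b | yes ab  = contradiction (≈-trans a₀b (≈-sym ab)) ¬a₀a
  ... | no _    | yes _   | no _    = refl
  ... | no _    | no _    | yes _   = refl
  ... | no _    | no _    | no _    = refl

  pairs-split : ∀ a₀ L M →
                pairs L M ≡ class-size a₀ L * class-size a₀ M + pairs (outside a₀ L) (outside a₀ M)
  pairs-split a₀ L M = begin
    ∑[ a ∈ L ] ∑[ b ∈ M ] 𝟙 (a ≈? b)
      ≡⟨ ∑-cong L (λ a → ∑-cong M (𝟙-≈-split a₀ a)) ⟩
    ∑[ a ∈ L ] ∑[ b ∈ M ] (in₀ a * in₀ b + out₀ a * (out₀ b * 𝟙 (a ≈? b)))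
      ≡⟨ ∑-cong L (λ a → ∑-distrib-+ M _ _) ⟩
    ∑[ a ∈ L ] (∑[ b ∈ M ] in₀ a * in₀ b) + (∑[ b ∈ M ] out₀ a * (out₀ b * 𝟙 (a ≈? b)))
      ≡⟨ ∑-cong L (λ a → sym (cong₂ _+_ (*-distribˡ-∑ (in₀ a) M in₀) (*-distribˡ-∑ (out₀ a) M _))) ⟩
    ∑[ a ∈ L ] in₀ a * class-size a₀ M + out₀ a * (∑[ b ∈ M ] out₀ b * 𝟙 (a ≈? b))
      ≡⟨ ∑-distrib-+ L _ _ ⟩
    (∑[ a ∈ L ] in₀ a * class-size a₀ M) + (∑[ a ∈ L ] out₀ a * (∑[ b ∈ M ] out₀ b * 𝟙 (a ≈? b)))
      ≡⟨ cong₂ _+_ (sym (*-distribʳ-∑ (class-size a₀ M) L in₀)) (sym pairs-outside) ⟩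
    class-size a₀ L * class-size a₀ M + pairs (outside a₀ L) (outside a₀ M)
      ∎
    where
    open ≡-Reasoning
    in₀ out₀ : G → ℕ
    in₀ a = 𝟙 (a₀ ≈? a)
    out₀ a = 𝟙 (¬? (a₀ ≈? a))
    pairs-outside : pairs (outside a₀ L) (outside a₀ M) ≡ ∑[ a ∈ L ] out₀ a * (∑[ b ∈ M ] out₀ b * 𝟙 (a ≈? b))
    pairs-outside = trans (∑-filter _ L _) (∑-cong L (λ a → cong (out₀ a *_) (∑-filter _ M _)))

  pairs-cauchy-schwarz : ∀ L M → pairs L M * pairs L M ≤ pairs L L * pairs M M
  pairs-cauchy-schwarz L M = bounded (length L) L M ≤-refl
    where
    -- Recursion on a bound for length L, since outside a₀ L is shorter than L but not a subterm of it.
    open ≤-Reasoning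
    bounded : ∀ n L M → length L ≤ n → pairs L M * pairs L M ≤ pairs L L * pairs M M
    bounded _       []        M _           = z≤n
    bounded (suc n) L@(a₀ ∷ L′) M (s≤s |L′|≤n) = begin
      pairs L M * pairs L M
        ≡⟨ cong (λ k → k * k) (pairs-split a₀ L M) ⟩
      (x * y + pairs L₀ M₀) * (x * y + pairs L₀ M₀)
        ≤⟨ cauchy-schwarz₂ {x * y} {pairs L₀ M₀} {x * x} {pairs L₀ L₀} {y * y} {pairs M₀ M₀}
                           (≤-reflexive (*-interchange x y x y)) (bounded n L₀ M₀ |L₀|≤n) ⟩
      (x * x + pairs L₀ L₀) * (y * y + pairs M₀ M₀)
        ≡⟨ sym (cong₂ _*_ (pairs-split a₀ L L) (pairs-split a₀ M M)) ⟩
      pairs L L * pairs M M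
        ∎
      where
      x = class-size a₀ L
      y = class-size a₀ M
      L₀ = outside a₀ L
      M₀ = outside a₀ M
      |L₀|≤n : length L₀ ≤ n
      |L₀|≤n = begin
        length L₀
          ≡⟨ cong length (filter-reject (λ a → ¬? (a₀ ≈? a)) (λ ¬a₀≈a₀ → ¬a₀≈a₀ ≈-refl)) ⟩
        length (outside a₀ L′)
          ≤⟨ length-filter (λ a → ¬? (a₀ ≈? a)) L′ ⟩
        length L′
          ≤⟨ |L′|≤n ⟩
        n
          ∎

genKeySetoid : ℕ → ℕ → DecSetoid 0ℓ 0ℓ
genKeySetoid c u = record
  { Carrier          = GenKey c u
  ; _≈_              = _≐_
  ; isDecEquivalence = record
    { isEquivalence = record
      { refl  = λ i a → refl
      ; sym   = λ g≐h i a → sym (g≐h i a)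
      ; trans = λ g≐h h≐k i a → trans (g≐h i a) (h≐k i a)
      }
    ; _≟_ = _≐?_
    }
  }

shift : ∀ {c u n} → GenKey c u → Vec (Key c u) n → GenKey c u
shift q x i a = symDiff x i a xor q i a

symDiff-++ : ∀ {c u m n} (x : Vec (Key c u) m) (y : Vec (Key c u) n) i a →
             symDiff (x ++ y) i a ≡ symDiff x i a xor symDiff y i a
symDiff-++ []      y i a = refl
symDiff-++ (k ∷ x) y i a = trans (cong (posChars k i a xor_) (symDiff-++ x y i a))
                                 (sym (xor-assoc (posChars k i a) (symDiff x i a) (symDiff y i a)))

≐-pointwise-⇔ : ∀ {c u} {g h g′ h′ : GenKey c u} →
                (∀ i a → (g i a ≡ h i a) ⇔ (g′ i a ≡ h′ i a)) → (g ≐ h) ⇔ (g′ ≐ h′)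
≐-pointwise-⇔ e = mk⇔ (λ g≐h i a → Equivalence.to (e i a) (g≐h i a))
                      (λ g′≐h′ i a → Equivalence.from (e i a) (g′≐h′ i a))

symDiff-++-≐⇔ : ∀ {c u m n} p (x : Vec (Key c u) m) (y : Vec (Key c u) n) →
                (symDiff (x ++ y) ≐ p) ⇔ (shift p x ≐ shift ∅ y)
symDiff-++-≐⇔ p x y = ≐-pointwise-⇔ λ i a →
  subst (λ s → (s ≡ p i a) ⇔ (shift p x i a ≡ shift ∅ y i a)) (sym (symDiff-++ x y i a))
        (xor-≡-⇔ (symDiff x i a) (symDiff y i a) (p i a))

shift-≐⇔ : ∀ {c u n} q (x x′ : Vec (Key c u) n) → (shift q x ≐ shift q x′) ⇔ (symDiff (x ++ x′) ≐ ∅)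
shift-≐⇔ q x x′ = ≐-pointwise-⇔ λ i a →
  subst (λ s → (shift q x i a ≡ shift q x′ i a) ⇔ (s ≡ false)) (sym (symDiff-++ x x′ i a))
        (xor-cancelʳ-⇔ (symDiff x i a) (symDiff x′ i a) (q i a))

module _ {c u : ℕ} where

  open EqualPairs (genKeySetoid c u)

  pairs-map : ∀ {X Y : Set} (f : X → GenKey c u) (g : Y → GenKey c u) Xs Ys →
              pairs (map f Xs) (map g Ys) ≡ ∑[ x ∈ Xs ] ∑[ y ∈ Ys ] 𝟙 (f x ≐? g y)
  pairs-map f g Xs Ys = trans (∑-map f Xs _) (∑-cong Xs (λ x → ∑-map g Ys _))

  count≡pairs : ∀ {m n} p (A : Vec (List (Key c u)) m) (B : Vec (List (Key c u)) n) →
                length (filter (λ xs → symDiff xs ≐? p) (tuples (A ++ B)))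
                  ≡ pairs (map (shift p) (tuples A)) (map (shift ∅) (tuples B))
  count≡pairs p A B = begin
    length (filter (λ xs → symDiff xs ≐? p) (tuples (A ++ B)))
      ≡⟨ length-filter≡∑ (λ xs → symDiff xs ≐? p) (tuples (A ++ B)) ⟩
    ∑[ z ∈ tuples (A ++ B) ] 𝟙 (symDiff z ≐? p)
      ≡⟨ ∑-tuples-++ A B _ ⟩
    ∑[ x ∈ tuples A ] ∑[ y ∈ tuples B ] 𝟙 (symDiff (x ++ y) ≐? p)
      ≡⟨ ∑-cong (tuples A) (λ x → ∑-cong (tuples B) λ y →
           𝟙-⇔ (symDiff-++-≐⇔ p x y) (symDiff (x ++ y) ≐? p) (shift p x ≐? shift ∅ y)) ⟩
    ∑[ x ∈ tuples A ] ∑[ y ∈ tuples B ] 𝟙 (shift p x ≐? shift ∅ y)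
      ≡⟨ sym (pairs-map (shift p) (shift ∅) (tuples A) (tuples B)) ⟩
    pairs (map (shift p) (tuples A)) (map (shift ∅) (tuples B))
      ∎
    where open ≡-Reasoning

  pairs-shift≡emptyCount : ∀ {n} q (A : Vec (List (Key c u)) n) →
                           pairs (map (shift q) (tuples A)) (map (shift q) (tuples A)) ≡ emptyCount (A ++ A)
  pairs-shift≡emptyCount q A = begin
    pairs (map (shift q) (tuples A)) (map (shift q) (tuples A))
      ≡⟨ pairs-map (shift q) (shift q) (tuples A) (tuples A) ⟩
    ∑[ x ∈ tuples A ] ∑[ x′ ∈ tuples A ] 𝟙 (shift q x ≐? shift q x′)
      ≡⟨ ∑-cong (tuples A) (λ x → ∑-cong (tuples A) λ x′ →
           𝟙-⇔ (shift-≐⇔ q x x′) (shift q x ≐? shift q x′) (symDiff (x ++ x′) ≐? ∅)) ⟩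
    ∑[ x ∈ tuples A ] ∑[ x′ ∈ tuples A ] 𝟙 (symDiff (x ++ x′) ≐? ∅)
      ≡⟨ sym (∑-tuples-++ A A _) ⟩
    emptyCount (A ++ A)
      ∎
    where open ≡-Reasoning

lemma41 : (c u t : ℕ) (A : Vec (List (Key c u)) (2 * t)) (p : GenKey c u) →
            VAll.All Unique A →
            let N = length (filter (λ xs → all? (λ i → all? (λ a → symDiff xs i a ≟ p i a))) (tuples A))
            in N * N ≤ (dfact t ^ c) * (dfact t ^ c) * prodSizes A
lemma41 c u t A p uA with A₁ , A₂ , refl ← splitAt t A = begin
  N * N                                          ≡⟨ cong (λ k → k * k) (count≡pairs p A₁ A₂) ⟩
  pairs L₁ L₂ * pairs L₁ L₂                      ≤⟨ pairs-cauchy-schwarz L₁ L₂ ⟩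
  pairs L₁ L₁ * pairs L₂ L₂                      ≡⟨ cong₂ _*_ (pairs-shift≡emptyCount p A₁) (pairs-shift≡emptyCount ∅ A₂) ⟩
  emptyCount (A₁ ++ A₁) * emptyCount (A₂ ++ A₂)  ≤⟨ *-mono-≤ (emptyCount-++-self t A₁ u₁) (emptyCount-++-self (t + 0) A₂ u₂) ⟩
  D * P₁ * (dfact (t + 0) ^ c * P₂)              ≡⟨ cong (λ k → D * P₁ * (dfact k ^ c * P₂)) (+-identityʳ t) ⟩
  D * P₁ * (D * P₂)                              ≡⟨ regroup D P₁ P₂ ⟩
  D * D * (P₁ * P₂)                              ≡⟨ cong (D * D *_) (sym (prodSizes-++ A₁ A₂)) ⟩
  D * D * prodSizes (A₁ ++ A₂)                   ∎
  where
  open ≤-Reasoning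
  open EqualPairs (genKeySetoid c u)
  N = length (filter (λ xs → symDiff xs ≐? p) (tuples (A₁ ++ A₂)))
  L₁ = map (shift p) (tuples A₁)
  L₂ = map (shift ∅) (tuples A₂)
  u₁ = proj₁ (++⁻ A₁ uA)
  u₂ = proj₂ (++⁻ A₁ uA)
  D = dfact t ^ c
  P₁ = prodSizes A₁
  P₂ = prodSizes A₂
  regroup : ∀ d a b → d * a * (d * b) ≡ d * d * (a * b)
  regroup = solve-∀
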